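{- Let $k$ be a non-negative integer, $n=3k+3$, and label the vertices of $K_n$ as $v_0,v_1,\dots,v_{3k+2}$. Define $$\omega_0(v_i)=\begin{cases} k+2 & \text{if } i\in\{k,k+1,\dots,2k+2\},\\ i & \text{otherwise.}\end{cases}$$ Then $\omega_0$ is a $1$-clique configuration of $K_{3k+3}$ (in particular it cleans $K_{3k+3}$), and it uses a total of $4k^2+7k+6=\frac{4}{9}n^2+O(n)$ brushes.
   Context: $K_n$ is the complete graph on $n$ vertices. Parallel cleaning process on a graph $G=(V,E)$ with initial configuration $\omega_0:V\to\mathbb{N}\cup\{0\}$: $D_0=V$, $t=0$; $D_t(v)=|N(v)\cap D_t|$ if $v\in D_t$, else $0$; $\rho_{t+1}=\{v\in D_t:\omega_t(v)\ge D_t(v)\}$; if $\rho_{t+1}=\emptyset$ stop with $K=t$, final dirty set $D_K$ and final configuration $\omega_K$; otherwise $D_{t+1}=D_t\setminus\rho_{t+1}$, $\omega_{t+1}(v)=\omega_t(v)-D_t(v)+|N(v)\cap\rho_{t+1}|$ for $v\in\rho_{t+1}$, $\omega_{t+1}(u)=\omega_t(u)+|N(u)\cap\rho_{t+1}|$ for $u\in D_{t+1}$, other values unchanged, and repeat with $t+1$. $\omega_0$ cleans $G$ if $D_K=\emptyset$. A $1$-clique configuration of $K_n$ (vertices $v_0,\dots,v_{n-1}$) is an initial configuration $\omega_0$ that cleans $K_n$ with final configuration $\omega_K$ such that (1) $\omega_0(v_i)\le n-1$ for all $i$, and (2) there is a one-to-one correspondence between the elements of $\{\omega_0(v_0),\dots,\omega_0(v_{n-1})\}$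 and $\{\omega_K(v_0),\dots,\omega_K(v_{n-1})\}$ (i.e. $\omega_K$ is obtained from $\omega_0$ by relabeling the vertices). The total number of brushes used is $\sum_i\omega_0(v_i)$. -}

module Defs where

open import Data.Nat using (ℕ; zero; suc; _+_; _*_; _∸_; _≤_; _≤ᵇ_)
open import Data.Nat.Properties using (_≤?_)
open import Data.Bool using (Bool; true; false; _∧_; not; if_then_else_)
open import Data.Fin using (Fin; toℕ; _≟_)
open import Data.List using (List; map; foldr)
open import Data.Nat.ListAction using (sum)
open import Data.List.Base using (allFin)
open import Data.Product using (Σ; _×_; _,_; proj₁; proj₂; ∃-syntax)
open import Relation.Nullary using (¬_)
open import Relation.Nullary.Decidable using (does; ⌊_⌋)
open import Relation.Binary.PropositionalEquality using (_≡_)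
open import Data.Fin.Permutation using (Permutation′; _⟨$⟩ʳ_)

-- Vertices of the complete graph K_n are Fin n (v_i ↔ i).
-- A vertex set is a Boolean predicate; a configuration assigns brushes.
VSet : ℕ → Set
VSet n = Fin n → Bool

Config : ℕ → Set
Config n = Fin n → ℕ

sumFin : ∀ {n} → (Fin n → ℕ) → ℕ
sumFin {n} f = sum (map f (allFin n))

nbrCount : ∀ {n} → VSet n → Fin n → ℕ
nbrCount S v = sumFin (λ u → if (not (does (u ≟ v)) ∧ S u) then 1 else 0)

dirtyDeg : ∀ {n} → VSet n → Fin n → ℕ
dirtyDeg D v = if D v then nbrCount D v else 0

rho : ∀ {n} → VSet n → Config n → VSet n
rho D ω v = D v ∧ (dirtyDeg D v ≤ᵇ ω v)

State : ℕ → Set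
State n = VSet n × Config n

-- one step of the parallel cleaning process (when ρ is empty this is
-- the identity, matching the fact that the process has stopped)
step : ∀ {n} → State n → State n
step (D , ω) = D' , ω'
  where
  ρ = rho D ω
  D' = λ v → D v ∧ not (ρ v)
  ω' = λ v → if ρ v then (ω v ∸ dirtyDeg D v) + nbrCount ρ v
             else (if D' v then ω v + nbrCount ρ v else ω v)

stateAt : ∀ {n} → Config n → ℕ → State n
stateAt ω₀ zero = (λ _ → true) , ω₀
stateAt ω₀ (suc t) = step (stateAt ω₀ t)

IsEmpty : ∀ {n} → VSet n → Set
IsEmpty S = ∀ v → S v ≡ false

rhoAt : ∀ {n} → Config n → ℕ → VSet n
rhoAt ω₀ t = rho (proj₁ (stateAt ω₀ t)) (proj₂ (stateAt ω₀ t))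

-- The process stops at time K: ρ_{K+1} = ∅ and ρ_{t+1} ≠ ∅ for t < K.
StopsAt : ∀ {n} → Config n → ℕ → Set
StopsAt ω₀ K = IsEmpty (rhoAt ω₀ K) × (∀ t → suc t ≤ K → ¬ IsEmpty (rhoAt ω₀ t))

CleansWithFinal : ∀ {n} → Config n → Config n → Set
CleansWithFinal ω₀ ωK = ∃[ K ] (StopsAt ω₀ K
                          × IsEmpty (proj₁ (stateAt ω₀ K))
                          × (∀ v → proj₂ (stateAt ω₀ K) v ≡ ωK v))

Cleans : ∀ {n} → Config n → Set
Cleans {n} ω₀ = Σ (Config n) (CleansWithFinal ω₀)

OneClique : ∀ n → Config n → Set
OneClique n ω₀ = (∀ v → ω₀ v ≤ n ∸ 1)
               × Σ (Config n) (λ ωK → CleansWithFinal ω₀ ωK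
                   × Σ (Permutation′ n) (λ σ → ∀ v → ωK v ≡ ω₀ (σ ⟨$⟩ʳ v)))

omega0 : (k : ℕ) → Config (3 * k + 3)
omega0 k i = if (k ≤ᵇ toℕ i) ∧ (toℕ i ≤ᵇ 2 * k + 2) then k + 2 else toℕ i

module Submission where

-- The dirty set is always an initial segment [0, L) of the vertices, and after c vertices have
-- been cleaned every dirty vertex holds ω₀(v) + c brushes; so a dirty vertex fires exactly when
-- ω₀(v) + c ≥ L − 1. For ω₀ = omega0 k the high vertices v_i (i ≥ 2k + 3, ω₀ = i) are therefore
-- cleaned from the top in blocks: when m of them are clean the next m + 1 fire (the last block is
-- cut off at k), and the vertices v_a, v_{a+1}, … of a block end with the values m, m + 1, ….
-- Once k high vertices are clean the middle vertices (ω₀ = k + 2)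
-- fire together and keep k + 2, and then the low vertices v_i (i < k) fire and end with
-- i + 2k + 3 = ω₀(v_{i+2k+3}). So the high vertices end with a permutation of the low values
-- 0, …, k − 1, and the final configuration is a relabelling of ω₀.

open import Defs
open import Data.Nat using (ℕ; zero; suc; _+_; _*_; _∸_; _≤_; _<_; _≤ᵇ_; _<ᵇ_; z≤n; s≤s; z<s; s<s; s<s⁻¹)
open import Data.Nat.Properties hiding (_≟_)
open import Data.Nat.Induction using (<-rec)
open import Data.Nat.ListAction using (sum)
open import Data.Nat.Tactic.RingSolver using (solve-∀)
open import Data.Bool using (Bool; true; false; _∧_; not; if_then_else_)
open import Data.Bool.Properties using (∧-zeroʳ)
open import Data.Fin using (Fin; toℕ; fromℕ<; _≟_) renaming (zero to fzero; suc to fsuc)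
open import Data.Fin.Properties using (toℕ<n; toℕ-fromℕ<; toℕ-injective)
open import Data.Fin.Permutation using (Permutation′; permutation; _⟨$⟩ʳ_)
open import Data.List using (allFin)
open import Data.List.Properties using (map-tabulate; map-cong)
open import Data.Product using (Σ; _×_; _,_; proj₁; proj₂)
open import Data.Sum using (_⊎_; inj₁; inj₂)
open import Function using (_∘_)
open import Relation.Nullary using (¬_; Dec; does; yes; no; contradiction)
open import Relation.Nullary.Decidable using (dec-true; dec-false)
open import Relation.Binary.PropositionalEquality

<ᵇ-true : ∀ {m n} → m < n → (m <ᵇ n) ≡ true
<ᵇ-true {m} {n} = dec-true (m <? n)

<ᵇ-false : ∀ {m n} → n ≤ m → (m <ᵇ n) ≡ false
<ᵇ-false {m} {n} n≤m = dec-false (m <? n) (≤⇒≯ n≤m)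

≤ᵇ-true : ∀ {m n} → m ≤ n → (m ≤ᵇ n) ≡ true
≤ᵇ-true {m} {n} = dec-true (m ≤? n)

≤ᵇ-false : ∀ {m n} → n < m → (m ≤ᵇ n) ≡ false
≤ᵇ-false {m} {n} n<m = dec-false (m ≤? n) (<⇒≱ n<m)

data Position (a b x : ℕ) : Set where
  below  : x < a → Position a b x
  inside : a ≤ x → x < b → Position a b x
  above  : b ≤ x → Position a b x

position : ∀ {a b} x → Position a b x
position {a} {b} x with x <? a | x <? b
... | yes x<a | _       = below x<a
... | no  x≮a | yes x<b = inside (≮⇒≥ x≮a) x<b
... | no  _   | no  x≮b = above (≮⇒≥ x≮b)

x+m∸[a+r]+r≡x∸a+m : ∀ {a x r m} → a ≤ x → r ≤ m → x + m ∸ (a + r) + r ≡ x ∸ a + m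
x+m∸[a+r]+r≡x∸a+m {a} {r = r} a≤x r≤m with m≤n⇒∃[o]m+o≡n a≤x | m≤n⇒∃[o]m+o≡n r≤m
... | i , refl | j , refl = begin
    a + i + (r + j) ∸ (a + r) + r      ≡⟨ cong (λ y → y ∸ (a + r) + r) (regroup a i r j) ⟩
    (a + r) + (i + j) ∸ (a + r) + r    ≡⟨ cong (_+ r) (m+n∸m≡n (a + r) (i + j)) ⟩
    i + j + r                          ≡⟨ rearrange i j r ⟩
    i + (r + j)                        ≡⟨ cong (_+ (r + j)) (m+n∸m≡n a i) ⟨
    a + i ∸ a + (r + j)                ∎
  where
  open ≡-Reasoning
  regroup : ∀ a i r j → a + i + (r + j) ≡ (a + r) + (i + j)
  regroup = solve-∀
  rearrange : ∀ i j r → i + j + r ≡ i + (r + j)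
  rearrange = solve-∀

indicator : Bool → ℕ
indicator b = if b then 1 else 0

count : ∀ {n} → VSet n → ℕ
count S = sumFin (λ u → indicator (S u))

sumFin-suc : ∀ {n} (f : Fin (suc n) → ℕ) → sumFin f ≡ f fzero + sumFin (f ∘ fsuc)
sumFin-suc f = cong (f fzero +_)
  (trans (cong sum (map-tabulate fsuc f)) (sym (cong sum (map-tabulate (λ i → i) (f ∘ fsuc)))))

sumFin-cong : ∀ {n} {f g : Fin n → ℕ} → (∀ u → f u ≡ g u) → sumFin f ≡ sumFin g
sumFin-cong {n} f≗g = cong sum (map-cong f≗g (allFin n))

count-suc : ∀ {n} (S : VSet (suc n)) → count S ≡ indicator (S fzero) + count (S ∘ fsuc)
count-suc S = sumFin-suc (indicator ∘ S)

count-cong : ∀ {n} {S T : VSet n} → (∀ u → S u ≡ T u) → count S ≡ count T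
count-cong S≗T = sumFin-cong (cong indicator ∘ S≗T)

nbrCount-suc : ∀ {n} (S : VSet (suc n)) v →
               nbrCount S v ≡ indicator (not (does (fzero ≟ v)) ∧ S fzero)
                              + sumFin (λ u → indicator (not (does (fsuc u ≟ v)) ∧ S (fsuc u)))
nbrCount-suc S v = sumFin-suc (λ u → indicator (not (does (u ≟ v)) ∧ S u))

nbrCount+indicator≡count : ∀ {n} (S : VSet n) v → nbrCount S v + indicator (S v) ≡ count S
nbrCount+indicator≡count {suc n} S fzero = begin
    nbrCount S fzero + indicator (S fzero)  ≡⟨ cong (_+ indicator (S fzero)) (nbrCount-suc S fzero) ⟩
    count (S ∘ fsuc) + indicator (S fzero)  ≡⟨ +-comm (count (S ∘ fsuc)) _ ⟩
    indicator (S fzero) + count (S ∘ fsuc)  ≡⟨ count-suc S ⟨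
    count S                                 ∎
  where open ≡-Reasoning
nbrCount+indicator≡count {suc n} S (fsuc v) = begin
    nbrCount S (fsuc v) + indicator (S (fsuc v))
      ≡⟨ cong (_+ indicator (S (fsuc v))) (nbrCount-suc S (fsuc v)) ⟩
    indicator (S fzero) + nbrCount (S ∘ fsuc) v + indicator (S (fsuc v))
      ≡⟨ +-assoc (indicator (S fzero)) _ _ ⟩
    indicator (S fzero) + (nbrCount (S ∘ fsuc) v + indicator (S (fsuc v)))
      ≡⟨ cong (indicator (S fzero) +_) (nbrCount+indicator≡count (S ∘ fsuc) v) ⟩
    indicator (S fzero) + count (S ∘ fsuc)
      ≡⟨ count-suc S ⟨
    count S ∎
  where open ≡-Reasoning

nbrCount-member : ∀ {n} (S : VSet n) v {m} → S v ≡ true → count S ≡ suc m → nbrCount S v ≡ m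
nbrCount-member S v {m} Sv count≡ = +-cancelʳ-≡ 1 (nbrCount S v) m (begin
    nbrCount S v + 1                ≡⟨ cong (λ b → nbrCount S v + indicator b) Sv ⟨
    nbrCount S v + indicator (S v)  ≡⟨ nbrCount+indicator≡count S v ⟩
    count S                         ≡⟨ count≡ ⟩
    suc m                           ≡⟨ +-comm 1 m ⟩
    m + 1                           ∎)
  where open ≡-Reasoning

nbrCount-nonmember : ∀ {n} (S : VSet n) v → S v ≡ false → nbrCount S v ≡ count S
nbrCount-nonmember S v Sv = begin
    nbrCount S v                    ≡⟨ +-identityʳ (nbrCount S v) ⟨
    nbrCount S v + 0                ≡⟨ cong (λ b → nbrCount S v + indicator b) Sv ⟨
    nbrCount S v + indicator (S v)  ≡⟨ nbrCount+indicator≡count S v ⟩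
    count S                         ∎
  where open ≡-Reasoning

interval : ∀ {n} → ℕ → ℕ → VSet n
interval a b v = not (toℕ v <ᵇ a) ∧ (toℕ v <ᵇ b)

prefix : ∀ {n} → ℕ → VSet n
prefix = interval 0

count-interval : ∀ {n} a l → a + l ≤ n → count (interval {n} a (a + l)) ≡ l
count-interval {zero}  zero    zero    _ = refl
count-interval {suc n} zero    zero    _ =
  trans (count-suc (interval {suc n} 0 0)) (count-interval {n} 0 0 z≤n)
count-interval {suc n} zero    (suc l) (s≤s l≤n) =
  trans (count-suc (interval {suc n} 0 (suc l))) (cong suc (count-interval {n} 0 l l≤n))
count-interval {suc n} (suc a) l       (s≤s a+l≤n) =
  trans (count-suc (interval {suc n} (suc a) (suc a + l))) (count-interval {n} a l a+l≤n)

-- One step of the process on a dirty prefix of K_n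

-- c is the number of clean vertices: each of them has sent one brush to every dirty vertex.
record PrefixDirty {n} (ω₀ : Config n) (c L : ℕ) (s : State n) : Set where
  field
    dirty≡prefix  : ∀ v → proj₁ s v ≡ prefix L v
    dirty-brushes : ∀ v → toℕ v < L → proj₂ s v ≡ ω₀ v + c

module CleanBlock {n} {ω₀ : Config n} {c a r : ℕ} {s : State n}
    (inv : PrefixDirty ω₀ c (a + suc r) s) (a+1+r≤n : a + suc r ≤ n)
    (fires : ∀ v → a ≤ toℕ v → toℕ v < a + suc r → a + r ≤ ω₀ v + c)
    (waits : ∀ v → toℕ v < a → ω₀ v + c < a + r) where

  open PrefixDirty inv

  private
    D = proj₁ s
    ω = proj₂ s
    ρ = rho D ω
    L = a + suc r

    a<L : a < L
    a<L = m<m+n a z<s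

  dirtyDeg≡ : ∀ v → toℕ v < L → dirtyDeg D v ≡ a + r
  dirtyDeg≡ v x<L rewrite dirty≡prefix v | <ᵇ-true x<L =
    nbrCount-member D v (trans (dirty≡prefix v) (<ᵇ-true x<L))
      (trans (count-cong dirty≡prefix) (trans (count-interval 0 L a+1+r≤n) (+-suc a r)))

  rho≡interval : ∀ v → ρ v ≡ interval a L v
  rho≡interval v with position {a} {L} (toℕ v)
  ... | below x<a rewrite dirtyDeg≡ v (<-trans x<a a<L) | dirty-brushes v (<-trans x<a a<L)
                        | dirty≡prefix v | <ᵇ-true (<-trans x<a a<L) | <ᵇ-true x<a
                        = ≤ᵇ-false (waits v x<a)
  ... | inside a≤x x<L rewrite dirtyDeg≡ v x<L | dirty-brushes v x<L
                             | dirty≡prefix v | <ᵇ-true x<L | <ᵇ-false a≤x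
                             = ≤ᵇ-true (fires v a≤x x<L)
  ... | above L≤x rewrite dirty≡prefix v | <ᵇ-false L≤x | <ᵇ-false (≤-trans (<⇒≤ a<L) L≤x) = refl

  count-rho : count ρ ≡ suc r
  count-rho = trans (count-cong rho≡interval) (count-interval a (suc r) a+1+r≤n)

  nbrCount-rho-below : ∀ v → toℕ v < a → nbrCount ρ v ≡ suc r
  nbrCount-rho-below v x<a = trans (nbrCount-nonmember ρ v ρv≡false) count-rho
    where
    ρv≡false : ρ v ≡ false
    ρv≡false = trans (rho≡interval v) (cong (λ b → not b ∧ (toℕ v <ᵇ L)) (<ᵇ-true x<a))

  nbrCount-rho-inside : ∀ v → a ≤ toℕ v → toℕ v < L → nbrCount ρ v ≡ r
  nbrCount-rho-inside v a≤x x<L = nbrCount-member ρ v ρv≡true count-rho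
    where
    ρv≡true : ρ v ≡ true
    ρv≡true = trans (rho≡interval v) (cong₂ (λ b b′ → not b ∧ b′) (<ᵇ-false a≤x) (<ᵇ-true x<L))

  next : PrefixDirty ω₀ (c + suc r) a (step s)
  next = record { dirty≡prefix = dirty′ ; dirty-brushes = brushes′ }
    where
    dirty′ : ∀ v → D v ∧ not (ρ v) ≡ prefix a v
    dirty′ v rewrite rho≡interval v | dirty≡prefix v with position {a} {L} (toℕ v)
    ... | below x<a      rewrite <ᵇ-true x<a | <ᵇ-true (<-trans x<a a<L) = refl
    ... | inside a≤x x<L rewrite <ᵇ-false a≤x | <ᵇ-true x<L = refl
    ... | above L≤x      rewrite <ᵇ-false L≤x | <ᵇ-false (≤-trans (<⇒≤ a<L) L≤x) = refl
    brushes′ : ∀ v → toℕ v < a → proj₂ (step s) v ≡ ω₀ v + (c + suc r)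
    brushes′ v x<a rewrite rho≡interval v | dirty≡prefix v | <ᵇ-true x<a | <ᵇ-true (<-trans x<a a<L)
                         | dirty-brushes v (<-trans x<a a<L) | nbrCount-rho-below v x<a
                         = +-assoc (ω₀ v) c (suc r)

  fired-brushes : ∀ v → a ≤ toℕ v → toℕ v < L → proj₂ (step s) v ≡ ω₀ v + c ∸ (a + r) + r
  fired-brushes v a≤x x<L rewrite rho≡interval v | <ᵇ-false a≤x | <ᵇ-true x<L
    | dirtyDeg≡ v x<L | dirty-brushes v x<L | nbrCount-rho-inside v a≤x x<L = refl

  clean-unchanged : ∀ v → L ≤ toℕ v → proj₂ (step s) v ≡ ω v
  clean-unchanged v L≤x rewrite rho≡interval v | dirty≡prefix v | <ᵇ-false L≤x
    | <ᵇ-false (≤-trans (<⇒≤ a<L) L≤x) = refl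

  rho-nonempty : ¬ IsEmpty ρ
  rho-nonempty empty = contradiction (trans (sym (rho≡interval last)) (empty last)) last∈block
    where
    a+r<n : a + r < n
    a+r<n = ≤-trans (≤-reflexive (sym (+-suc a r))) a+1+r≤n
    last : Fin n
    last = fromℕ< a+r<n
    last∈block : interval a L last ≢ false
    last∈block rewrite toℕ-fromℕ< a+r<n | <ᵇ-false (m≤m+n a r) | <ᵇ-true (≤-reflexive (sym (+-suc a r)))
      = λ ()

ActiveBefore : ∀ {n} → Config n → ℕ → Set
ActiveBefore ω₀ t = ∀ t′ → t′ < t → ¬ IsEmpty (rhoAt ω₀ t′)

activeBefore-suc : ∀ {n} {ω₀ : Config n} {t} →
                   ActiveBefore ω₀ t → ¬ IsEmpty (rhoAt ω₀ t) → ActiveBefore ω₀ (suc t)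
activeBefore-suc active nonempty t′ t′<1+t with m≤n⇒m<n∨m≡n (≤-pred t′<1+t)
... | inj₁ t′<t = active t′ t′<t
... | inj₂ refl = nonempty

rho-of-empty : ∀ {n} {D : VSet n} (ω : Config n) → IsEmpty D → IsEmpty (rho D ω)
rho-of-empty ω empty v rewrite empty v = refl

cleansWithFinal : ∀ {n} {ω₀ : Config n} {K} → ActiveBefore ω₀ K → IsEmpty (proj₁ (stateAt ω₀ K)) →
                  CleansWithFinal ω₀ (proj₂ (stateAt ω₀ K))
cleansWithFinal {K = K} active clean = K , (rho-of-empty _ clean , active) , clean , λ _ → refl

-- Bijections between ranges of ℕ

infix 4 _≤_<_
_≤_<_ : ℕ → ℕ → ℕ → Set
a ≤ x < b = (a ≤ x) × (x < b)

record RangeInverse (a b c d : ℕ) (f g : ℕ → ℕ) : Set where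
  field
    f-range : ∀ {x} → a ≤ x < b → c ≤ f x < d
    g-range : ∀ {y} → c ≤ y < d → a ≤ g y < b
    g∘f     : ∀ {x} → a ≤ x < b → g (f x) ≡ x
    f∘g     : ∀ {y} → c ≤ y < d → f (g y) ≡ y

id-inverse : ∀ {a b} → RangeInverse a b a b (λ x → x) (λ y → y)
id-inverse = record { f-range = λ p → p ; g-range = λ p → p ; g∘f = λ _ → refl ; f∘g = λ _ → refl }

shift-inverse : ∀ {a b c d} l → a + l ≡ b → c + l ≡ d →
                RangeInverse a b c d (λ x → x ∸ a + c) (λ y → y ∸ c + a)
shift-inverse {a} {c = c} l refl refl = record
  { f-range = shift-range a c
  ; g-range = shift-range c a
  ; g∘f     = shift-back a c
  ; f∘g     = shift-back c a
  }
  where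
  shift-range : ∀ p q {x} → p ≤ x < p + l → q ≤ x ∸ p + q < q + l
  shift-range p q {x} (p≤x , x<p+l) = m≤n+m q (x ∸ p) , subst (_< q + l) (+-comm q (x ∸ p))
    (+-monoʳ-< q (subst (x ∸ p <_) (m+n∸m≡n p l) (∸-monoˡ-< x<p+l p≤x)))
  shift-back : ∀ p q {x} → p ≤ x < p + l → x ∸ p + q ∸ q + p ≡ x
  shift-back p q {x} (p≤x , _) = trans (cong (_+ p) (m+n∸n≡m (x ∸ p) q)) (m∸n+n≡m p≤x)

swap-blocks : ∀ {a b c d e f} {f₁ g₁ f₂ g₂ : ℕ → ℕ} → a ≤ b → b ≤ c → d ≤ e → e ≤ f →
              RangeInverse a b e f f₁ g₁ → RangeInverse b c d e f₂ g₂ →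
              RangeInverse a c d f (λ x → if x <ᵇ b then f₁ x else f₂ x)
                                   (λ y → if y <ᵇ e then g₂ y else g₁ y)
swap-blocks {a} {b} {c} {d} {e} {f} {f₁} {g₁} {f₂} {g₂} a≤b b≤c d≤e e≤f inv₁ inv₂ = record
  { f-range = to-range ; g-range = from-range ; g∘f = from∘to ; f∘g = to∘from }
  where
  module I₁ = RangeInverse inv₁
  module I₂ = RangeInverse inv₂
  to from : ℕ → ℕ
  to   x = if x <ᵇ b then f₁ x else f₂ x
  from y = if y <ᵇ e then g₂ y else g₁ y
  to-range : ∀ {x} → a ≤ x < c → d ≤ to x < f
  to-range {x} (a≤x , x<c) with x <? b
  ... | yes x<b rewrite <ᵇ-true x<b =
    let (e≤y , y<f) = I₁.f-range (a≤x , x<b) in ≤-trans d≤e e≤y , y<f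
  ... | no  x≮b rewrite <ᵇ-false (≮⇒≥ x≮b) =
    let (d≤y , y<e) = I₂.f-range (≮⇒≥ x≮b , x<c) in d≤y , <-≤-trans y<e e≤f
  from-range : ∀ {y} → d ≤ y < f → a ≤ from y < c
  from-range {y} (d≤y , y<f) with y <? e
  ... | yes y<e rewrite <ᵇ-true y<e =
    let (b≤x , x<c) = I₂.g-range (d≤y , y<e) in ≤-trans a≤b b≤x , x<c
  ... | no  y≮e rewrite <ᵇ-false (≮⇒≥ y≮e) =
    let (a≤x , x<b) = I₁.g-range (≮⇒≥ y≮e , y<f) in a≤x , <-≤-trans x<b b≤c
  from∘to : ∀ {x} → a ≤ x < c → from (to x) ≡ x
  from∘to {x} (a≤x , x<c) with x <? b
  ... | yes x<b rewrite <ᵇ-true x<b | <ᵇ-false (proj₁ (I₁.f-range (a≤x , x<b))) = I₁.g∘f (a≤x , x<b)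
  ... | no  x≮b rewrite <ᵇ-false (≮⇒≥ x≮b) | <ᵇ-true (proj₂ (I₂.f-range (≮⇒≥ x≮b , x<c))) =
    I₂.g∘f (≮⇒≥ x≮b , x<c)
  to∘from : ∀ {y} → d ≤ y < f → to (from y) ≡ y
  to∘from {y} (d≤y , y<f) with y <? e
  ... | yes y<e rewrite <ᵇ-true y<e | <ᵇ-false (proj₁ (I₂.g-range (d≤y , y<e))) = I₂.f∘g (d≤y , y<e)
  ... | no  y≮e rewrite <ᵇ-false (≮⇒≥ y≮e) | <ᵇ-true (proj₂ (I₁.g-range (≮⇒≥ y≮e , y<f))) =
    I₁.f∘g (≮⇒≥ y≮e , y<f)

module _ {n} {f g : ℕ → ℕ} (inv : RangeInverse 0 n 0 n f g) where
  open RangeInverse inv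

  rangePermutation : Permutation′ n
  rangePermutation = permutation to from to∘from from∘to
    where
    to from : Fin n → Fin n
    to   v = fromℕ< (proj₂ (f-range (z≤n , toℕ<n v)))
    from v = fromℕ< (proj₂ (g-range (z≤n , toℕ<n v)))
    to∘from : ∀ v → to (from v) ≡ v
    to∘from v = toℕ-injective (trans (toℕ-fromℕ< _) (trans (cong f (toℕ-fromℕ< _)) (f∘g (z≤n , toℕ<n v))))
    from∘to : ∀ v → from (to v) ≡ v
    from∘to v = toℕ-injective (trans (toℕ-fromℕ< _) (trans (cong g (toℕ-fromℕ< _)) (g∘f (z≤n , toℕ<n v))))

  toℕ-rangePermutation : ∀ v → toℕ (rangePermutation ⟨$⟩ʳ v) ≡ f (toℕ v)
  toℕ-rangePermutation v = toℕ-fromℕ< _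

sumBelow : (ℕ → ℕ) → ℕ → ℕ
sumBelow f zero    = 0
sumBelow f (suc n) = f 0 + sumBelow (f ∘ suc) n

sumFin-toℕ : ∀ n (f : ℕ → ℕ) → sumFin {n} (f ∘ toℕ) ≡ sumBelow f n
sumFin-toℕ zero    f = refl
sumFin-toℕ (suc n) f = trans (sumFin-suc {n} (f ∘ toℕ)) (cong (f 0 +_) (sumFin-toℕ n (f ∘ suc)))

sumBelow-+ : ∀ a b (f : ℕ → ℕ) → sumBelow f (a + b) ≡ sumBelow f a + sumBelow (λ i → f (a + i)) b
sumBelow-+ zero    b f = refl
sumBelow-+ (suc a) b f = trans (cong (f 0 +_) (sumBelow-+ a b (f ∘ suc))) (sym (+-assoc (f 0) _ _))

sumBelow-cong : ∀ n {f g : ℕ → ℕ} → (∀ i → i < n → f i ≡ g i) → sumBelow f n ≡ sumBelow g n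
sumBelow-cong zero    f≗g = refl
sumBelow-cong (suc n) f≗g = cong₂ _+_ (f≗g 0 z<s) (sumBelow-cong n (λ i i<n → f≗g (suc i) (s<s i<n)))

sumBelow-const : ∀ n c → sumBelow (λ _ → c) n ≡ n * c
sumBelow-const zero    c = refl
sumBelow-const (suc n) c = cong (c +_) (sumBelow-const n c)

sumBelow-+const : ∀ n c (f : ℕ → ℕ) → sumBelow (λ i → c + f i) n ≡ n * c + sumBelow f n
sumBelow-+const zero    c f = refl
sumBelow-+const (suc n) c f rewrite sumBelow-+const n c (f ∘ suc) =
  lemma c (f 0) (n * c) (sumBelow (f ∘ suc) n)
  where
  lemma : ∀ c x y z → c + x + (y + z) ≡ c + y + (x + z)
  lemma = solve-∀

sumBelow-id : ∀ n → 2 * sumBelow (λ i → i) n + n ≡ n * n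
sumBelow-id zero    = refl
sumBelow-id (suc n) = begin
    2 * sumBelow suc n + suc n                    ≡⟨ cong (λ s → 2 * s + suc n) (sumBelow-+const n 1 (λ i → i)) ⟩
    2 * (n * 1 + S) + suc n                       ≡⟨ lemma n S ⟩
    (2 * S + n) + (2 * n + 1)                     ≡⟨ cong (_+ (2 * n + 1)) (sumBelow-id n) ⟩
    n * n + (2 * n + 1)                           ≡⟨ square-suc n ⟩
    suc n * suc n                                 ∎
  where
  open ≡-Reasoning
  S = sumBelow (λ i → i) n
  lemma : ∀ n s → 2 * (n * 1 + s) + suc n ≡ (2 * s + n) + (2 * n + 1)
  lemma = solve-∀
  square-suc : ∀ n → n * n + (2 * n + 1) ≡ suc n * suc n
  square-suc = solve-∀

-- The configuration omega0

omega0ℕ : ℕ → ℕ → ℕ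
omega0ℕ k x = if (k ≤ᵇ x) ∧ (x ≤ᵇ 2 * k + 2) then k + 2 else x

module _ {k x : ℕ} where

  omega0ℕ-low : x < k → omega0ℕ k x ≡ x
  omega0ℕ-low x<k rewrite ≤ᵇ-false x<k = refl

  omega0ℕ-middle : k ≤ x → x ≤ 2 * k + 2 → omega0ℕ k x ≡ k + 2
  omega0ℕ-middle k≤x x≤2k+2 rewrite ≤ᵇ-true k≤x | ≤ᵇ-true x≤2k+2 = refl

  omega0ℕ-high : 2 * k + 2 < x → omega0ℕ k x ≡ x
  omega0ℕ-high 2k+2<x rewrite ≤ᵇ-false 2k+2<x | ∧-zeroʳ (k ≤ᵇ x) = refl

  omega0ℕ-≤ : x ≤ 2 * k + 2 → omega0ℕ k x ≤ k + 2
  omega0ℕ-≤ x≤2k+2 with k ≤? x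
  ... | yes k≤x = ≤-reflexive (omega0ℕ-middle k≤x x≤2k+2)
  ... | no  k≰x = subst (_≤ k + 2) (sym (omega0ℕ-low (≰⇒> k≰x))) (≤-trans (<⇒≤ (≰⇒> k≰x)) (m≤m+n k 2))

module Run (k : ℕ) where

  -- v_i is low for i < k, middle for k ≤ i < p and high for p ≤ i.
  n p : ℕ
  n = 3 * k + 3
  p = suc (2 * k + 2)

  ω₀ : Config n
  ω₀ = omega0 k

  brushesAt : ℕ → Config n
  brushesAt t = proj₂ (stateAt ω₀ t)

  n≡p+k : n ≡ p + k
  n≡p+k = lemma k
    where
    lemma : ∀ k → 3 * k + 3 ≡ suc (2 * k + 2) + k
    lemma = solve-∀

  toℕ<p+k : ∀ (v : Fin n) → toℕ v < p + k
  toℕ<p+k v = subst (toℕ v <_) n≡p+k (toℕ<n v)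

  k≤p : k ≤ p
  k≤p = ≤-trans (m≤m+n k (k + 0)) (≤-trans (m≤m+n (2 * k) 2) (n≤1+n _))

  omega0-bound : ∀ v → ω₀ v ≤ n ∸ 1
  omega0-bound v = subst (ω₀ v ≤_) (sym (cong (_∸ 1) (+-suc (3 * k) 2))) (bound (toℕ v ≤? 2 * k + 2))
    where
    bound : Dec (toℕ v ≤ 2 * k + 2) → ω₀ v ≤ 3 * k + 2
    bound (yes x≤2k+2) = ≤-trans (omega0ℕ-≤ x≤2k+2) (≤-trans (m≤n+m (k + 2) (2 * k)) (≤-reflexive (lemma k)))
      where
      lemma : ∀ k → 2 * k + (k + 2) ≡ 3 * k + 2
      lemma = solve-∀
    bound (no  x≰2k+2) = subst (_≤ 3 * k + 2) (sym (omega0ℕ-high {k} (≰⇒> x≰2k+2)))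
                               (≤-pred (subst (toℕ v <_) (+-suc (3 * k) 2) (toℕ<n v)))

  sum-low : sumBelow (omega0ℕ k) k ≡ sumBelow (λ i → i) k
  sum-low = sumBelow-cong k (λ _ i<k → omega0ℕ-low i<k)

  sum-middle : sumBelow (λ i → omega0ℕ k (k + i)) (k + 3) ≡ (k + 3) * (k + 2)
  sum-middle = trans (sumBelow-cong (k + 3) (λ i i<k+3 → omega0ℕ-middle (m≤m+n k i) (k+i≤2k+2 i<k+3)))
                     (sumBelow-const (k + 3) (k + 2))
    where
    lemma : ∀ k → k + (k + 2) ≡ 2 * k + 2
    lemma = solve-∀
    k+i≤2k+2 : ∀ {i} → i < k + 3 → k + i ≤ 2 * k + 2
    k+i≤2k+2 {i} i<k+3 = ≤-trans (+-monoʳ-≤ k (≤-pred (subst (i <_) (+-suc k 2) i<k+3))) (≤-reflexive (lemma k))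

  sum-high : sumBelow (λ i → omega0ℕ k (k + (k + 3) + i)) k ≡ k * (k + (k + 3)) + sumBelow (λ i → i) k
  sum-high = trans (sumBelow-cong k (λ i _ → omega0ℕ-high {k} (≤-trans 2k+2<k+[k+3] (m≤m+n _ i))))
                   (sumBelow-+const k (k + (k + 3)) (λ i → i))
    where
    lemma : ∀ k → suc (2 * k + 2) ≡ k + (k + 3)
    lemma = solve-∀
    2k+2<k+[k+3] : 2 * k + 2 < k + (k + 3)
    2k+2<k+[k+3] = ≤-reflexive (lemma k)

  total-brushes : sumFin ω₀ ≡ 4 * (k * k) + 7 * k + 6
  total-brushes = +-cancelʳ-≡ k _ _ (begin
    sumFin ω₀ + k                                           ≡⟨ cong (_+ k) (sumFin-toℕ n (omega0ℕ k)) ⟩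
    sumBelow (omega0ℕ k) n + k                              ≡⟨ cong (λ l → sumBelow (omega0ℕ k) l + k) (split k) ⟩
    sumBelow (omega0ℕ k) (k + (k + 3) + k) + k
      ≡⟨ cong (_+ k) (sumBelow-+ (k + (k + 3)) k (omega0ℕ k)) ⟩
    sumBelow (omega0ℕ k) (k + (k + 3)) + H + k
      ≡⟨ cong (λ s → s + H + k) (sumBelow-+ k (k + 3) (omega0ℕ k)) ⟩
    sumBelow (omega0ℕ k) k + sumBelow (λ i → omega0ℕ k (k + i)) (k + 3) + H + k
      ≡⟨ cong (_+ k) (cong₂ _+_ (cong₂ _+_ sum-low sum-middle) sum-high) ⟩
    S + (k + 3) * (k + 2) + (k * (k + (k + 3)) + S) + k     ≡⟨ regroup k S ⟩
    (2 * S + k) + (k + 3) * (k + 2) + k * (k + (k + 3))     ≡⟨ cong (λ s → s + (k + 3) * (k + 2) + k * (k + (k + 3)))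
                                                                    (sumBelow-id k) ⟩
    k * k + (k + 3) * (k + 2) + k * (k + (k + 3))           ≡⟨ total k ⟩
    4 * (k * k) + 7 * k + 6 + k                             ∎)
    where
    open ≡-Reasoning
    S = sumBelow (λ i → i) k
    H = sumBelow (λ i → omega0ℕ k (k + (k + 3) + i)) k
    split : ∀ k → 3 * k + 3 ≡ k + (k + 3) + k
    split = solve-∀
    regroup : ∀ k S → S + (k + 3) * (k + 2) + (k * (k + (k + 3)) + S) + k
                      ≡ (2 * S + k) + (k + 3) * (k + 2) + k * (k + (k + 3))
    regroup = solve-∀
    total : ∀ k → k * k + (k + 3) * (k + 2) + k * (k + (k + 3)) ≡ 4 * (k * k) + 7 * k + 6 + k
    total = solve-∀

  high-fires : ∀ {a r m} v → p ≤ a → a ≤ toℕ v → r ≤ m → a + r ≤ ω₀ v + m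
  high-fires {a} {r} {m} v p≤a a≤x r≤m =
    subst (a + r ≤_) (sym (cong (_+ m) (omega0ℕ-high {k} (≤-trans p≤a a≤x)))) (+-mono-≤ a≤x r≤m)

  high-fired-brushes : ∀ {a r m} v → p ≤ a → a ≤ toℕ v → r ≤ m →
                       ω₀ v + m ∸ (a + r) + r ≡ toℕ v ∸ a + m
  high-fired-brushes {a} {r} {m} v p≤a a≤x r≤m =
    trans (cong (λ y → y + m ∸ (a + r) + r) (omega0ℕ-high {k} (≤-trans p≤a a≤x)))
          (x+m∸[a+r]+r≡x∸a+m a≤x r≤m)

  -- The block of high vertices that fires next either contains every dirty high vertex (e ≡ 0)
  -- or has exactly m + 1 vertices (m ≤ r together with r ≤ m).
  waits-in-high-phase : ∀ {m e r} v → m ≤ k → e ≡ 0 ⊎ m ≤ r → toℕ v < p + e → ω₀ v + m < p + e + r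
  waits-in-high-phase {m} {e} {r} v m≤k last-or-doubling x<p+e with toℕ v <? p | last-or-doubling
  ... | yes x<p | _ = <-≤-trans (s≤s low-or-middle) (≤-trans (m≤m+n p e) (m≤m+n (p + e) r))
    where
    lemma : ∀ k → k + 2 + k ≡ 2 * k + 2
    lemma = solve-∀
    low-or-middle : ω₀ v + m ≤ 2 * k + 2
    low-or-middle = ≤-trans (+-mono-≤ (omega0ℕ-≤ (≤-pred x<p)) m≤k) (≤-reflexive (lemma k))
  ... | no  x≮p | inj₁ e≡0 =
    contradiction (subst (λ e → toℕ v < p + e) e≡0 x<p+e)
                  (≤⇒≯ (≤-trans (≤-reflexive (+-identityʳ p)) (≮⇒≥ x≮p)))
  ... | no  x≮p | inj₂ m≤r =
    subst (_< p + e + r) (sym (cong (_+ m) (omega0ℕ-high {k} (≮⇒≥ x≮p)))) (+-mono-<-≤ x<p+e m≤r)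

  record HighPhase (t m e : ℕ) : Set where
    field
      m+e≡k         : m + e ≡ k
      prefix-dirty  : PrefixDirty ω₀ m (p + e) (stateAt ω₀ t)
      active        : ActiveBefore ω₀ t
      final final⁻¹ : ℕ → ℕ
      final-inverse : RangeInverse (p + e) (p + k) 0 m final final⁻¹
      high-brushes  : ∀ v → p + e ≤ toℕ v → brushesAt t v ≡ final (toℕ v)

  high-start : HighPhase 0 0 k
  high-start = record
    { m+e≡k         = refl
    ; prefix-dirty  = record
      { dirty≡prefix  = λ v → sym (<ᵇ-true (toℕ<p+k v))
      ; dirty-brushes = λ v _ → sym (+-identityʳ (ω₀ v))
      }
    ; active        = λ _ ()
    ; final-inverse = shift-inverse 0 (+-identityʳ (p + k)) refl
    ; high-brushes  = λ v p+k≤x → contradiction (toℕ<p+k v) (≤⇒≯ p+k≤x)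
    }

  high-step : ∀ {t m e r} → HighPhase t m (e + suc r) → r ≤ m → e ≡ 0 ⊎ m ≤ r →
              HighPhase (suc t) (m + suc r) e
  high-step {t} {m} {e} {r} phase r≤m last-or-doubling = record
    { m+e≡k         = trans (+-assoc m (suc r) e) (trans (cong (m +_) (+-comm (suc r) e)) m+e≡k)
    ; prefix-dirty  = B.next
    ; active        = activeBefore-suc active B.rho-nonempty
    ; final-inverse = swap-blocks (+-monoʳ-≤ p (m≤m+n e (suc r))) (+-monoʳ-≤ p e+1+r≤k) z≤n (m≤m+n m (suc r))
                                  (shift-inverse (suc r) (sym L≡) refl) final-inverse
    ; high-brushes  = high-brushes′
    }
    where
    open HighPhase phase
    a = p + e
    L≡ : p + (e + suc r) ≡ a + suc r
    L≡ = sym (+-assoc p e (suc r))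
    e+1+r≤k : e + suc r ≤ k
    e+1+r≤k = subst (e + suc r ≤_) m+e≡k (m≤n+m (e + suc r) m)
    m≤k : m ≤ k
    m≤k = subst (m ≤_) m+e≡k (m≤m+n m (e + suc r))
    module B = CleanBlock (subst (λ L → PrefixDirty ω₀ m L (stateAt ω₀ t)) L≡ prefix-dirty)
                          (subst (_≤ n) L≡ (subst (p + (e + suc r) ≤_) (sym n≡p+k) (+-monoʳ-≤ p e+1+r≤k)))
                          (λ v a≤x _ → high-fires v (m≤m+n p e) a≤x r≤m)
                          (λ v x<a → waits-in-high-phase v m≤k last-or-doubling x<a)
    high-brushes′ : ∀ v → a ≤ toℕ v →
                    brushesAt (suc t) v ≡ (if toℕ v <ᵇ p + (e + suc r) then toℕ v ∸ a + m else final (toℕ v))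
    high-brushes′ v a≤x with toℕ v <? p + (e + suc r)
    ... | yes x<L rewrite <ᵇ-true x<L =
      trans (B.fired-brushes v a≤x (subst (toℕ v <_) L≡ x<L)) (high-fired-brushes v (m≤m+n p e) a≤x r≤m)
    ... | no  x≮L rewrite <ᵇ-false (≮⇒≥ x≮L) =
      trans (B.clean-unchanged v (subst (_≤ toℕ v) L≡ (≮⇒≥ x≮L))) (high-brushes v (≮⇒≥ x≮L))

  HighPhaseEnds : ℕ → Set
  HighPhaseEnds e = ∀ {t m} → HighPhase t m e → Σ ℕ λ t′ → HighPhase t′ k 0

  high-phase-ends : ∀ e → HighPhaseEnds e
  high-phase-ends = <-rec HighPhaseEnds go
    where
    go : ∀ e → (∀ {e′} → e′ < e → HighPhaseEnds e′) → HighPhaseEnds e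
    go zero    _   {t} {m} phase =
      t , subst (λ m → HighPhase t m 0) (trans (sym (+-identityʳ m)) (HighPhase.m+e≡k phase)) phase
    go (suc e) rec {t} {m} phase with suc m ≤? suc e
    ... | yes m<1+e = rec (s≤s (m∸n≤m e m))
                          (high-step (subst (HighPhase t m) (sym (m∸n+n≡m m<1+e)) phase) ≤-refl (inj₂ ≤-refl))
    ... | no  m≮1+e = rec {0} z<s (high-step phase (<⇒≤ (s<s⁻¹ (≰⇒> m≮1+e))) (inj₁ refl))

  record LowDirty (t : ℕ) : Set where
    field
      prefix-dirty   : PrefixDirty ω₀ p k (stateAt ω₀ t)
      active         : ActiveBefore ω₀ t
      final final⁻¹  : ℕ → ℕ
      final-inverse  : RangeInverse p (p + k) 0 k final final⁻¹
      middle-brushes : ∀ v → k ≤ toℕ v → toℕ v < p → brushesAt t v ≡ k + 2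
      high-brushes   : ∀ v → p ≤ toℕ v → brushesAt t v ≡ final (toℕ v)

  p≡k+[k+3] : p ≡ k + suc (k + 2)
  p≡k+[k+3] = lemma k
    where
    lemma : ∀ k → suc (2 * k + 2) ≡ k + suc (k + 2)
    lemma = solve-∀

  middle-fires : ∀ v → k ≤ toℕ v → toℕ v < k + suc (k + 2) → k + (k + 2) ≤ ω₀ v + k
  middle-fires v k≤x x<p = subst (k + (k + 2) ≤_) (cong (_+ k) (sym (omega0ℕ-middle k≤x x≤2k+2)))
                                 (≤-reflexive (+-comm k (k + 2)))
    where
    x≤2k+2 : toℕ v ≤ 2 * k + 2
    x≤2k+2 = ≤-pred (subst (toℕ v <_) (sym p≡k+[k+3]) x<p)

  low-waits : ∀ v → toℕ v < k → ω₀ v + k < k + (k + 2)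
  low-waits v x<k = subst (_< k + (k + 2)) (cong (_+ k) (sym (omega0ℕ-low x<k)))
                          (<-≤-trans (+-monoˡ-< k x<k) (+-monoʳ-≤ k (m≤m+n k 2)))

  middle-step : ∀ {t} → HighPhase t k 0 → LowDirty (suc t)
  middle-step {t} phase = record
    { prefix-dirty   = subst (λ c → PrefixDirty ω₀ c k (stateAt ω₀ (suc t))) (sym p≡k+[k+3]) B.next
    ; active         = activeBefore-suc active B.rho-nonempty
    ; final-inverse  = subst (λ a → RangeInverse a (p + k) 0 k final final⁻¹) (+-identityʳ p) final-inverse
    ; middle-brushes = middle-brushes′
    ; high-brushes   = λ v p≤x → trans (B.clean-unchanged v (subst (_≤ toℕ v) p≡k+[k+3] p≤x))
                                       (high-brushes v (subst (_≤ toℕ v) (sym (+-identityʳ p)) p≤x))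
    }
    where
    open HighPhase phase
    module B = CleanBlock (subst (λ L → PrefixDirty ω₀ k L (stateAt ω₀ t)) (trans (+-identityʳ p) p≡k+[k+3])
                                 prefix-dirty)
                          (subst (_≤ n) p≡k+[k+3] (subst (p ≤_) (sym n≡p+k) (m≤m+n p k)))
                          middle-fires low-waits
    middle-brushes′ : ∀ v → k ≤ toℕ v → toℕ v < p → brushesAt (suc t) v ≡ k + 2
    middle-brushes′ v k≤x x<p = begin
      brushesAt (suc t) v                    ≡⟨ B.fired-brushes v k≤x (subst (toℕ v <_) p≡k+[k+3] x<p) ⟩
      ω₀ v + k ∸ (k + (k + 2)) + (k + 2)     ≡⟨ cong (λ y → y + k ∸ (k + (k + 2)) + (k + 2))
                                                     (omega0ℕ-middle k≤x (≤-pred x<p)) ⟩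
      k + 2 + k ∸ (k + (k + 2)) + (k + 2)    ≡⟨ cong (λ y → y ∸ (k + (k + 2)) + (k + 2)) (+-comm (k + 2) k) ⟩
      k + (k + 2) ∸ (k + (k + 2)) + (k + 2)  ≡⟨ cong (_+ (k + 2)) (n∸n≡0 (k + (k + 2))) ⟩
      k + 2                                  ∎
      where open ≡-Reasoning

  record Cleaned (K : ℕ) : Set where
    field
      active         : ActiveBefore ω₀ K
      clean          : IsEmpty (proj₁ (stateAt ω₀ K))
      final final⁻¹  : ℕ → ℕ
      final-inverse  : RangeInverse p (p + k) 0 k final final⁻¹
      low-brushes    : ∀ v → toℕ v < k → brushesAt K v ≡ toℕ v + p
      middle-brushes : ∀ v → k ≤ toℕ v → toℕ v < p → brushesAt K v ≡ k + 2
      high-brushes   : ∀ v → p ≤ toℕ v → brushesAt K v ≡ final (toℕ v)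

  low-step : ∀ {t} → LowDirty t → Σ ℕ Cleaned
  low-step {t} low with 0 <? k
  ... | no  0≮k = t , record
    { active         = active
    ; clean          = λ v → trans (dirty≡prefix v) (<ᵇ-false (≤-trans (≤-reflexive k≡0) z≤n))
    ; final-inverse  = final-inverse
    ; low-brushes    = λ v x<k → contradiction (≤-trans x<k (≤-reflexive k≡0)) (λ ())
    ; middle-brushes = middle-brushes
    ; high-brushes   = high-brushes
    }
    where
    open LowDirty low
    open PrefixDirty prefix-dirty
    k≡0 : k ≡ 0
    k≡0 = n≤0⇒n≡0 (≮⇒≥ 0≮k)
  ... | yes 0<k with m≤n⇒∃[o]m+o≡n 0<k
  ... | r , 1+r≡k = suc t , record
    { active         = activeBefore-suc active B.rho-nonempty
    ; clean          = PrefixDirty.dirty≡prefix B.next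
    ; final-inverse  = final-inverse
    ; low-brushes    = low-brushes′
    ; middle-brushes = λ v k≤x x<p → trans (B.clean-unchanged v (subst (_≤ toℕ v) (sym 1+r≡k) k≤x))
                                         (middle-brushes v k≤x x<p)
    ; high-brushes   = λ v p≤x → trans (B.clean-unchanged v (subst (_≤ toℕ v) (sym 1+r≡k) (≤-trans k≤p p≤x)))
                                       (high-brushes v p≤x)
    }
    where
    open LowDirty low
    r≤ω₀+p : ∀ v → r ≤ ω₀ v + p
    r≤ω₀+p v = ≤-trans (n≤1+n r) (≤-trans (≤-reflexive 1+r≡k) (≤-trans k≤p (m≤n+m p (ω₀ v))))
    module B = CleanBlock {a = 0} (subst (λ L → PrefixDirty ω₀ p L (stateAt ω₀ t)) (sym 1+r≡k) prefix-dirty)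
                          (subst (_≤ n) (sym 1+r≡k) (≤-trans k≤p (subst (p ≤_) (sym n≡p+k) (m≤m+n p k))))
                          (λ v _ _ → r≤ω₀+p v) (λ _ ())
    low-brushes′ : ∀ v → toℕ v < k → brushesAt (suc t) v ≡ toℕ v + p
    low-brushes′ v x<k = begin
      brushesAt (suc t) v  ≡⟨ B.fired-brushes v z≤n (subst (toℕ v <_) (sym 1+r≡k) x<k) ⟩
      ω₀ v + p ∸ r + r     ≡⟨ m∸n+n≡m (r≤ω₀+p v) ⟩
      ω₀ v + p             ≡⟨ cong (_+ p) (omega0ℕ-low x<k) ⟩
      toℕ v + p            ∎
      where open ≡-Reasoning

  cleaned : Σ ℕ Cleaned
  cleaned = low-step (middle-step (proj₂ (high-phase-ends k high-start)))

  oneClique : OneClique n ω₀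
  oneClique = omega0-bound , brushesAt K , cleansWithFinal active clean , rangePermutation relabelling , relabels
    where
    K = proj₁ cleaned
    open Cleaned (proj₂ cleaned)
    σ σ⁻¹ : ℕ → ℕ
    σ   x = if x <ᵇ k then x ∸ 0 + p else (if x <ᵇ p then x else final x)
    σ⁻¹ y = if y <ᵇ p then (if y <ᵇ k then final⁻¹ y else y) else y ∸ p + 0
    relabelling : RangeInverse 0 n 0 n σ σ⁻¹
    relabelling = subst (λ b → RangeInverse 0 b 0 b σ σ⁻¹) (sym n≡p+k)
      (swap-blocks z≤n (m≤n+m k p) z≤n (m≤m+n p k) (shift-inverse k refl refl)
        (swap-blocks k≤p (m≤m+n p k) z≤n k≤p id-inverse final-inverse))
    relabels : ∀ v → brushesAt K v ≡ ω₀ (rangePermutation relabelling ⟨$⟩ʳ v)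
    relabels v rewrite toℕ-rangePermutation relabelling v with position {k} {p} (toℕ v)
    ... | below x<k rewrite <ᵇ-true x<k =
      trans (low-brushes v x<k) (sym (omega0ℕ-high {k} (m≤n+m p (toℕ v))))
    ... | inside k≤x x<p rewrite <ᵇ-false k≤x | <ᵇ-true x<p =
      trans (middle-brushes v k≤x x<p) (sym (omega0ℕ-middle k≤x (≤-pred x<p)))
    ... | above p≤x rewrite <ᵇ-false (≤-trans k≤p p≤x) | <ᵇ-false p≤x =
      trans (high-brushes v p≤x) (sym (omega0ℕ-low final<k))
      where
      final<k : final (toℕ v) < k
      final<k = proj₂ (RangeInverse.f-range final-inverse (p≤x , toℕ<p+k v))

mainTheorem3 : (k : ℕ) → OneClique (3 * k + 3) (omega0 k)
               × sumFin (omega0 k) ≡ 4 * (k * k) + 7 * k + 6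
mainTheorem3 k = Run.oneClique k , Run.total-brushes k
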